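{- Let $\mathbf{s}$ be a Sturmian word and, for $n\ge1$, let $G_n=(V_n,E_n)$ be its abelian Rauzy graph of order $n$. Then $\#E_1=3$ and $\#E_n=4$ for all $n\ge2$. Moreover, for all $n\ge1$, $\#(E_n/\equiv_L)+\#(E_n/\equiv_R)=6$.
   Context: A Sturmian word is an infinite binary word with exactly $n+1$ factors of length $n$ for each $n$. For an infinite binary word $\mathbf{z}$, its abelian Rauzy graph of order $n$ is the directed labeled graph whose vertices are the Parikh vectors $\Psi(w)=(|w|_0,|w|_1)$ of length-$n$ factors $w$ of $\mathbf{z}$, with an edge from $\vec{x}$ to $\vec{y}$ labeled $(a,b)\in\{0,1\}^2$ whenever some factor $aub$ of length $n+1$ satisfies $\Psi(au)=\vec{x}$ and $\Psi(ub)=\vec{y}$ (edges are determined by source, target and label). On the edge set, $\equiv_R$ identifies two edges iff they have the same source vertex and the same second label component (edge $\vec{x}\xrightarrow{(a,b)}\vec{y}$ is mapped to $(\vec{x},b)$), and $\equiv_L$ identifies two edges iff they have the same target vertex and the same first label component (edge mapped to $(a,\vec{y})$). -}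

module Defs where

open import Data.Bool using (Bool; true; false)
open import Data.Nat using (ℕ; zero; suc; _+_)
open import Data.Product using (_×_; _,_; Σ; ∃; ∃-syntax)
open import Data.List using (List; length)
open import Data.List.Relation.Unary.Unique.Propositional using (Unique)
open import Data.List.Membership.Propositional using (_∈_)
open import Data.Vec using (Vec; []; _∷_)
open import Function.Bundles using (_⇔_)
open import Relation.Binary.PropositionalEquality using (_≡_)

-- Letters: false = 0, true = 1.  An infinite binary word is a map ℕ → Bool.
Word : Set
Word = ℕ → Bool

HasSize : {A : Set} → (A → Set) → ℕ → Set
HasSize {A} P k =
  Σ (List A) λ l → Unique l × length l ≡ k × (∀ x → (x ∈ l) ⇔ P x)

factorAt : Word → ℕ → (n : ℕ) → Vec Bool n
factorAt z i zero    = []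
factorAt z i (suc n) = z i ∷ factorAt z (suc i) n

IsFactor : Word → (n : ℕ) → Vec Bool n → Set
IsFactor z n w = ∃[ i ] factorAt z i n ≡ w

Sturmian : Word → Set
Sturmian z = ∀ n → HasSize (IsFactor z n) (suc n)

count0 count1 : ∀ {n} → Vec Bool n → ℕ
count0 []           = 0
count0 (false ∷ w)  = suc (count0 w)
count0 (true ∷ w)   = count0 w
count1 []           = 0
count1 (false ∷ w)  = count1 w
count1 (true ∷ w)   = suc (count1 w)

Ψ : ∀ {n} → Vec Bool n → ℕ × ℕ
Ψ w = count0 w , count1 w

-- Edges of the abelian Rauzy graph of order n: (source , label (a , b) , target).
Edge : Set
Edge = (ℕ × ℕ) × (Bool × Bool) × (ℕ × ℕ)

-- x --(a,b)--> y is an edge iff some factor a u b of length n+1 (occurring at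
-- position i) has Ψ(au) = x and Ψ(ub) = y.  Here au = z[i..i+n-1],
-- ub = z[i+1..i+n], a = z i, b = z (i + n).  (Meaningful for n ≥ 1.)
IsEdge : Word → ℕ → Edge → Set
IsEdge z n (x , (a , b) , y) =
  ∃[ i ] (Ψ (factorAt z i n) ≡ x × Ψ (factorAt z (suc i) n) ≡ y
          × z i ≡ a × z (i + n) ≡ b)

-- Classes of ≡_R : images (x , b) of edges x --(a,b)--> y
IsRClass : Word → ℕ → (ℕ × ℕ) × Bool → Set
IsRClass z n (x , b) = ∃[ a ] ∃[ y ] IsEdge z n (x , (a , b) , y)

-- Classes of ≡_L : images (a , y) of edges x --(a,b)--> y
IsLClass : Word → ℕ → Bool × (ℕ × ℕ) → Set
IsLClass z n (a , y) = ∃[ x ] ∃[ b ] IsEdge z n (x , (a , b) , y)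

{-# OPTIONS --safe #-}
-- A Sturmian word is aperiodic (in an eventually periodic word all factors of some length M
-- start below M, so there are at most M of them) and balanced: a shortest unbalanced pair of
-- factors has the form 0w0, 1w1 with w a palindrome, and then 0w and 1w would both be right
-- special, against there being only one right special factor of each length.  So the factors of
-- length n have k or k + 1 ones, the abelian Rauzy graph has the two vertices of these weights,
-- and each edge is the rise (0,1) from the lower to the upper vertex, the fall (1,0) back, a
-- diagonal loop (0,0) below or (1,1) above, or an off-diagonal loop (1,1) below or (0,0) above.
-- Aperiodicity forces rise and fall.  Balance in length n + 1 excludes one of the diagonal loops,
-- in length n - 1 one of the off-diagonal loops; aperiodicity forces the other diagonal loop and,
-- for n ≥ 2, the other off-diagonal loop, which for n = 1 cannot exist.  An off-diagonal loop
-- shares its ≡R and ≡L classes with rise and fall, so each kind of class has exactly 3 elements.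
module Submission where

open import Defs
open import Data.Bool using (Bool; true; false; not)
open import Data.Bool.Properties using (not-¬; ¬-not) renaming (_≟_ to _≟ᵇ_)
open import Data.Empty using (⊥; ⊥-elim)
open import Data.Fin using (toℕ)
import Data.Fin.Properties as Fin
open import Data.List using (List; []; _∷_; _++_; length; lookup; map; applyUpTo)
open import Data.List.Properties using (length-map; length-applyUpTo)
open import Data.List.Membership.Propositional using (_∈_; find; lose)
open import Data.List.Membership.Propositional.Properties using (∈-map⁺; ∈-map⁻; ∈-applyUpTo⁺; ∈-++⁺ˡ)
open import Data.List.Relation.Unary.All as All using (All; []; _∷_)
open import Data.List.Relation.Unary.All.Properties using (++⁺)
open import Data.List.Relation.Unary.AllPairs using ([]; _∷_)
open import Data.List.Relation.Unary.Any using (here; there; index; any?)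
open import Data.List.Relation.Unary.Any.Properties using (lookup-index)
open import Data.List.Relation.Unary.Unique.Propositional using (Unique)
import Data.List.Relation.Unary.Unique.Propositional.Properties as Unique
open import Data.Nat
open import Data.Nat.Induction using (<-rec)
open import Data.Nat.Properties
open import Data.Nat.Solver using (module +-*-Solver)
open +-*-Solver using (solve; _:+_; _:=_)
open import Data.Product using (Σ; ∃; ∃₂; ∃-syntax; _×_; _,_; proj₁; proj₂)
import Data.Product.Properties as Product
open import Data.Sum using (_⊎_; inj₁; inj₂)
open import Data.Vec as Vec using (Vec; []; _∷_; _∷ʳ_)
open import Data.Vec.Properties using (∷-injective; ∷ʳ-injective; ≡-dec; init-∷ʳ; last-∷ʳ)
open import Function.Base using (_∘_; _∘′_; case_of_)
open import Function.Bundles using (_⇔_; mk⇔; Equivalence)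
open import Relation.Binary.Definitions using (DecidableEquality; tri<; tri≈; tri>)
open import Relation.Binary.PropositionalEquality
open import Relation.Nullary using (Dec; yes; no; ¬_; ¬?)
open import Relation.Nullary.Decidable using (decidable-stable)
open import Relation.Unary using (Decidable)

module _ {A : Set} where

  ∈-remove : ∀ {x : A} {ys} → x ∈ ys →
    ∃ λ ys′ → length ys ≡ suc (length ys′) × (∀ y → y ∈ ys → y ≢ x → y ∈ ys′)
  ∈-remove {ys = _ ∷ ys} (here refl) =
    ys , refl , λ { _ (here refl) y≢x → ⊥-elim (y≢x refl) ; _ (there y∈) _ → y∈ }
  ∈-remove {ys = y ∷ _} (there x∈) with ys′ , len , keep ← ∈-remove x∈ =
    y ∷ ys′ , cong suc len , λ { _ (here refl) _ → here refl ; y′ (there y∈) y≢x → there (keep y′ y∈ y≢x) }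

  unique-⊆⇒length-≤ : ∀ (xs ys : List A) → Unique xs → (∀ x → x ∈ xs → x ∈ ys) → length xs ≤ length ys
  unique-⊆⇒length-≤ []       ys _              _   = z≤n
  unique-⊆⇒length-≤ (x ∷ xs) ys (x∉xs ∷ uxs) xs⊆ys with ys′ , len , keep ← ∈-remove (xs⊆ys x (here refl)) =
    subst (suc (length xs) ≤_) (sym len) (s≤s (unique-⊆⇒length-≤ xs ys′ uxs λ y y∈xs →
      keep y (xs⊆ys y (there y∈xs)) λ y≡x → All.lookup x∉xs y∈xs (sym y≡x)))

  pigeonhole : ∀ {N} (f : ℕ → A) (ys : List A) → (∀ x → x < N → f x ∈ ys) → length ys < N →
               ∃₂ λ x y → x < y × y < N × f x ≡ f y
  pigeonhole f ys f∈ys len<N =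
    let i , j , i<j , same = Fin.pigeonhole len<N (λ x → index (f∈ys (toℕ x) (Fin.toℕ<n x)))
    in toℕ i , toℕ j , i<j , Fin.toℕ<n j ,
       trans (lookup-index (f∈ys (toℕ i) _))
             (trans (cong (lookup ys) same) (sym (lookup-index (f∈ys (toℕ j) _))))

  HasSize-⇔ : ∀ {P Q : A → Set} {k} → (∀ x → P x ⇔ Q x) → HasSize P k → HasSize Q k
  HasSize-⇔ P⇔Q (l , u , len , l⇔P) =
    l , u , len , λ x → mk⇔ (λ x∈ → Equivalence.to (P⇔Q x) (Equivalence.to (l⇔P x) x∈))
                            (λ q → Equivalence.from (l⇔P x) (Equivalence.from (P⇔Q x) q))

module _ {A B : Set} where

  image-hasSize : ∀ {P : A → Set} (f : A → B) (xs : List A) → Unique (map f xs) → All P xs →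
                  (∀ a → P a → f a ∈ map f xs) →
                  HasSize (λ b → ∃ λ a → P a × f a ≡ b) (length xs)
  image-hasSize {P} f xs u all image⊆ =
    map f xs , u , length-map f xs , λ b → mk⇔ to (λ { (a , pa , refl) → image⊆ a pa })
    where
    to : ∀ {b} → b ∈ map f xs → ∃ λ a → P a × f a ≡ b
    to b∈ with a , a∈ , refl ← ∈-map⁻ f b∈ = a , All.lookup all a∈ , refl

last-before : ∀ {P : ℕ → Set} → Decidable P → ∀ {x₀ x} → x₀ < x → P x₀ →
  ∃ λ y → x₀ ≤ y × y < x × P y × (∀ y′ → y < y′ → y′ < x → ¬ P y′)
last-before {P} P? {x₀} {suc x} x₀<1+x Px₀ with P? x
... | yes Px = x , ≤-pred x₀<1+x , ≤-refl , Px , λ y′ x<y′ y′<1+x → ⊥-elim (<⇒≱ x<y′ (≤-pred y′<1+x))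
... | no ¬Px with m<1+n⇒m<n∨m≡n x₀<1+x
...   | inj₂ refl = ⊥-elim (¬Px Px₀)
...   | inj₁ x₀<x with y , x₀≤y , y<x , Py , none ← last-before P? x₀<x Px₀ =
  y , x₀≤y , m≤n⇒m≤1+n y<x , Py , λ y′ y<y′ y′<1+x → case m<1+n⇒m<n∨m≡n y′<1+x of λ
    { (inj₁ y′<x) → none y′ y<y′ y′<x
    ; (inj₂ refl) → ¬Px }

bit : Bool → ℕ
bit false = 0
bit true  = 1

bit-injective : ∀ {a b} → bit a ≡ bit b → a ≡ b
bit-injective {false} {false} _ = refl
bit-injective {true}  {true}  _ = refl

count1-∷ : ∀ {n} x (v : Vec Bool n) → count1 (x ∷ v) ≡ bit x + count1 v
count1-∷ false v = refl
count1-∷ true  v = refl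

count0+count1≡length : ∀ {n} (v : Vec Bool n) → count0 v + count1 v ≡ n
count0+count1≡length []          = refl
count0+count1≡length (false ∷ v) = cong suc (count0+count1≡length v)
count0+count1≡length (true ∷ v)  = trans (+-suc (count0 v) (count1 v)) (cong suc (count0+count1≡length v))

count1≤length : ∀ {n} (v : Vec Bool n) → count1 v ≤ n
count1≤length {n} v = subst (count1 v ≤_) (count0+count1≡length v) (m≤n+m (count1 v) (count0 v))

unbalanced-bits : ∀ a c {X Y} → X ≤ suc Y → suc (suc (bit c + Y)) ≤ bit a + X → a ≡ true × c ≡ false
unbalanced-bits false c     X≤1+Y ub       = ⊥-elim (<⇒≱ (≤-trans ub X≤1+Y) (s≤s (m≤n+m _ (bit c))))
unbalanced-bits true  true  X≤1+Y (s≤s ub) = ⊥-elim (<⇒≱ (≤-trans ub X≤1+Y) ≤-refl)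
unbalanced-bits true  false _     _        = refl , refl

ψ : ℕ → ℕ → ℕ × ℕ
ψ n w = n ∸ w , w

Ψ≡ψ : ∀ {n} (v : Vec Bool n) → Ψ v ≡ ψ n (count1 v)
Ψ≡ψ {n} v = cong (_, count1 v) (sym (begin
  n ∸ count1 v                       ≡⟨ cong (_∸ count1 v) (sym (count0+count1≡length v)) ⟩
  count0 v + count1 v ∸ count1 v     ≡⟨ m+n∸n≡m (count0 v) (count1 v) ⟩
  count0 v                           ∎))
  where open ≡-Reasoning

module Factors (z : Word) where

  weight : ℕ → ℕ → ℕ
  weight i d = count1 (factorAt z i d)

  weight≤length : ∀ i d → weight i d ≤ d
  weight≤length i d = count1≤length (factorAt z i d)

  weight-suc : ∀ i d → weight i (suc d) ≡ bit (z i) + weight (suc i) d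
  weight-suc i d = count1-∷ (z i) (factorAt z (suc i) d)

  weight-+ : ∀ i a b → weight i (a + b) ≡ weight i a + weight (i + a) b
  weight-+ i zero    b rewrite +-identityʳ i = refl
  weight-+ i (suc a) b rewrite weight-suc i (a + b) | weight-+ (suc i) a b | weight-suc i a | +-suc i a =
    sym (+-assoc (bit (z i)) (weight (suc i) a) _)

  factorAt-suc : ∀ i d → factorAt z i (suc d) ≡ factorAt z i d ∷ʳ z (i + d)
  factorAt-suc i zero    rewrite +-identityʳ i = refl
  factorAt-suc i (suc d) rewrite +-suc i d = cong (z i ∷_) (factorAt-suc (suc i) d)

  factorAt-≡ : ∀ d a b → (∀ t → t < d → z (a + t) ≡ z (b + t)) → factorAt z a d ≡ factorAt z b d
  factorAt-≡ zero    a b same = refl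
  factorAt-≡ (suc d) a b same = cong₂ _∷_
    (subst₂ (λ x y → z x ≡ z y) (+-identityʳ a) (+-identityʳ b) (same 0 z<s))
    (factorAt-≡ d (suc a) (suc b) λ t t<d →
      subst₂ (λ x y → z x ≡ z y) (+-suc a t) (+-suc b t) (same (suc t) (s<s t<d)))

  factorAt-≡⁻ : ∀ d a b → factorAt z a d ≡ factorAt z b d → ∀ t → t < d → z (a + t) ≡ z (b + t)
  factorAt-≡⁻ (suc d) a b eq zero    _ rewrite +-identityʳ a | +-identityʳ b = proj₁ (∷-injective eq)
  factorAt-≡⁻ (suc d) a b eq (suc t) (s<s t<d) rewrite +-suc a t | +-suc b t =
    factorAt-≡⁻ d (suc a) (suc b) (proj₂ (∷-injective eq)) t t<d

  weight-cong : ∀ d a b → (∀ t → t < d → z (a + t) ≡ z (b + t)) → weight a d ≡ weight b d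
  weight-cong d a b same = cong count1 (factorAt-≡ d a b same)

  factorAt-step : ∀ {m a b} → factorAt z a m ≡ factorAt z b m → z (a + m) ≡ z (b + m) →
                  factorAt z (suc a) m ≡ factorAt z (suc b) m
  factorAt-step {m} {a} {b} same next = proj₂ (∷-injective (begin
    factorAt z a (suc m)            ≡⟨ factorAt-suc a m ⟩
    factorAt z a m ∷ʳ z (a + m)     ≡⟨ cong₂ _∷ʳ_ same next ⟩
    factorAt z b m ∷ʳ z (b + m)     ≡⟨ factorAt-suc b m ⟨
    factorAt z b (suc m)            ∎))
    where open ≡-Reasoning

  factorAt-steps : ∀ {m a b} → factorAt z a m ≡ factorAt z b m → ∀ L →
    (∀ s → s < L → factorAt z (a + s) m ≡ factorAt z (b + s) m → z (a + s + m) ≡ z (b + s + m)) →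
    factorAt z (a + L) m ≡ factorAt z (b + L) m
  factorAt-steps {m} {a} {b} same zero    _    = subst₂ (λ x y → factorAt z x m ≡ factorAt z y m)
                                                   (sym (+-identityʳ a)) (sym (+-identityʳ b)) same
  factorAt-steps {m} {a} {b} same (suc L) next = subst₂ (λ x y → factorAt z x m ≡ factorAt z y m)
    (sym (+-suc a L)) (sym (+-suc b L)) (factorAt-step before (next L ≤-refl before))
    where
    before : factorAt z (a + L) m ≡ factorAt z (b + L) m
    before = factorAt-steps same L (λ s s<L → next s (m≤n⇒m≤1+n s<L))

  repeat⇒periodic : ∀ m a P → factorAt z a m ≡ factorAt z (a + P) m →
    (∀ s → factorAt z (a + s) m ≡ factorAt z (a + P + s) m → z (a + s + m) ≡ z (a + P + s + m)) →
    ∀ i → a + m ≤ i → z (i + P) ≡ z i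
  repeat⇒periodic m a P same next i a+m≤i = begin
    z (i + P)            ≡⟨ cong (λ x → z (x + P)) i≡ ⟨
    z (a + m + s + P)    ≡⟨ cong z (solve 4 (λ a m s P → a :+ m :+ s :+ P := a :+ P :+ s :+ m) refl a m s P) ⟩
    z (a + P + s + m)    ≡⟨ next s (factorAt-steps same s (λ s′ _ → next s′)) ⟨
    z (a + s + m)        ≡⟨ cong z (solve 3 (λ a m s → a :+ s :+ m := a :+ m :+ s) refl a m s) ⟩
    z (a + m + s)        ≡⟨ cong z i≡ ⟩
    z i                  ∎
    where
    open ≡-Reasoning
    s : ℕ
    s = i ∸ (a + m)
    i≡ : a + m + s ≡ i
    i≡ = m+[n∸m]≡n a+m≤i

  weight-head : ∀ {i d b} → z i ≡ b → weight i (suc d) ≡ bit b + weight (suc i) d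
  weight-head {i} {d} refl = weight-suc i d

  weight-last : ∀ {i d b} → z (i + d) ≡ b → weight i (suc d) ≡ bit b + weight i d
  weight-last {i} {d} refl = begin
    weight i (suc d)                 ≡⟨ cong (weight i) (+-comm 1 d) ⟩
    weight i (d + 1)                 ≡⟨ weight-+ i d 1 ⟩
    weight i d + weight (i + d) 1    ≡⟨ +-comm (weight i d) _ ⟩
    weight (i + d) 1 + weight i d    ≡⟨ cong (_+ weight i d) (trans (weight-suc (i + d) 0) (+-identityʳ _)) ⟩
    bit (z (i + d)) + weight i d     ∎
    where open ≡-Reasoning

  prefix-weights⇒factorAt-≡ : ∀ m a b → (∀ d → d ≤ m → weight a d ≡ weight b d) → factorAt z a m ≡ factorAt z b m
  prefix-weights⇒factorAt-≡ m a b same = factorAt-≡ m a b λ t t<m →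
    bit-injective (+-cancelʳ-≡ (weight a t) _ _ (begin
      bit (z (a + t)) + weight a t    ≡⟨ weight-last refl ⟨
      weight a (suc t)                ≡⟨ same (suc t) t<m ⟩
      weight b (suc t)                ≡⟨ weight-last refl ⟩
      bit (z (b + t)) + weight b t    ≡⟨ cong (bit (z (b + t)) +_) (same t (<⇒≤ t<m)) ⟨
      bit (z (b + t)) + weight a t    ∎))
    where open ≡-Reasoning

  symmetric-weights⇒palindrome : ∀ m a → (∀ d e → d + e ≡ m → weight a d ≡ weight (a + e) d) →
                                 ∀ t e → suc t + e ≡ m → z (a + t) ≡ z (a + e)
  symmetric-weights⇒palindrome m a symmetric t e t+e≡m = bit-injective (+-cancelʳ-≡ (weight a t) _ _ (begin
    bit (z (a + t)) + weight a t                 ≡⟨ weight-last refl ⟨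
    weight a (suc t)                             ≡⟨ symmetric (suc t) e t+e≡m ⟩
    weight (a + e) (suc t)                       ≡⟨ weight-head refl ⟩
    bit (z (a + e)) + weight (suc (a + e)) t     ≡⟨ cong (λ x → bit (z (a + e)) + weight x t) (+-suc a e) ⟨
    bit (z (a + e)) + weight (a + suc e) t       ≡⟨ cong (bit (z (a + e)) +_) (symmetric t (suc e) (trans (+-suc t e) t+e≡m)) ⟨
    bit (z (a + e)) + weight a t                 ∎))
    where open ≡-Reasoning

  Balanced : ℕ → Set
  Balanced d = ∀ i j → weight i d ≤ suc (weight j d)

  balanced-drop : ∀ {X Y} d x y → Balanced d → weight x d ≡ suc X → weight y d ≡ Y → X ≤ Y
  balanced-drop d x y balanced wx wy = ≤-pred (subst₂ _≤_ wx (cong suc wy) (balanced x y))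

  -- Of an unbalanced pair of windows of minimal length m + 2, the heavier is 1w1 and the
  -- lighter 0w0 for one palindrome w.
  module MinimalUnbalanced (m i j : ℕ) (balanced : ∀ d → d ≤ suc m → Balanced d)
                           (unbalanced : suc (suc (weight j (suc (suc m)))) ≤ weight i (suc (suc m))) where

    heads : z i ≡ true × z j ≡ false
    heads = unbalanced-bits (z i) (z j) (balanced (suc m) ≤-refl (suc i) (suc j))
              (subst₂ (λ x y → suc (suc x) ≤ y) (weight-head refl) (weight-head refl) unbalanced)
    lasts : z (i + suc m) ≡ true × z (j + suc m) ≡ false
    lasts = unbalanced-bits (z (i + suc m)) (z (j + suc m)) (balanced (suc m) ≤-refl i j)
              (subst₂ (λ x y → suc (suc x) ≤ y) (weight-last refl) (weight-last refl) unbalanced)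

    zi≡1 : z i ≡ true
    zi≡1 = proj₁ heads
    zj≡0 : z j ≡ false
    zj≡0 = proj₂ heads
    zi′≡1 : z (suc i + m) ≡ true
    zi′≡1 = trans (cong z (sym (+-suc i m))) (proj₁ lasts)
    zj′≡0 : z (suc j + m) ≡ false
    zj′≡0 = trans (cong z (sym (+-suc j m))) (proj₂ lasts)

    p q : ℕ
    p = suc i
    q = suc j

    prefix-≤ : ∀ d → d ≤ m → weight p d ≤ weight q d
    prefix-≤ d d≤m = balanced-drop (suc d) i j (balanced (suc d) (s≤s d≤m)) (weight-head zi≡1) (weight-head zj≡0)

    suffix-≤ : ∀ d e → d + e ≡ m → weight (p + d) e ≤ weight (q + d) e
    suffix-≤ d e d+e≡m =
      balanced-drop (suc e) (p + d) (q + d) (balanced (suc e) (s≤s (subst (e ≤_) d+e≡m (m≤n+m e d))))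
      (weight-last (trans (cong z (trans (+-assoc p d e) (cong (p +_) d+e≡m))) zi′≡1))
      (weight-last (trans (cong z (trans (+-assoc q d e) (cong (q +_) d+e≡m))) zj′≡0))

    middle-weight : weight p m ≡ weight q m
    middle-weight = ≤-antisym (prefix-≤ m ≤-refl) (≤-pred (≤-pred (subst₂ (λ x y → suc (suc x) ≤ y)
      (trans (weight-head zj≡0) (weight-last zj′≡0))
      (trans (weight-head zi≡1) (cong suc (weight-last zi′≡1)))
      unbalanced)))

    prefix-weights : ∀ d → d ≤ m → weight p d ≡ weight q d
    prefix-weights d d≤m = ≤-antisym (prefix-≤ d d≤m) (+-cancelʳ-≤ (weight (q + d) e) _ _ (begin
      weight q d + weight (q + d) e   ≡⟨ weight-+ q d e ⟨
      weight q (d + e)                ≡⟨ cong (weight q) d+e≡m ⟩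
      weight q m                      ≡⟨ middle-weight ⟨
      weight p m                      ≡⟨ cong (weight p) d+e≡m ⟨
      weight p (d + e)                ≡⟨ weight-+ p d e ⟩
      weight p d + weight (p + d) e   ≤⟨ +-monoʳ-≤ (weight p d) (suffix-≤ d e d+e≡m) ⟩
      weight p d + weight (q + d) e   ∎))
      where
      open ≤-Reasoning
      e : ℕ
      e = m ∸ d
      d+e≡m : d + e ≡ m
      d+e≡m = m+[n∸m]≡n d≤m

    same-middle : factorAt z q m ≡ factorAt z p m
    same-middle = prefix-weights⇒factorAt-≡ m q p λ d d≤m → sym (prefix-weights d d≤m)

    middle-factor-weight : ∀ e d → e + d ≤ m → weight (q + e) d ≡ weight (p + e) d
    middle-factor-weight e d e+d≤m = weight-cong d (q + e) (p + e) λ t t<d →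
      subst₂ (λ x y → z x ≡ z y) (sym (+-assoc q e t)) (sym (+-assoc p e t))
        (factorAt-≡⁻ m q p same-middle (e + t) (<-≤-trans (+-monoʳ-< e t<d) e+d≤m))

    palindrome : ∀ t e → suc t + e ≡ m → z (p + t) ≡ z (p + e)
    palindrome = symmetric-weights⇒palindrome m p λ d e d+e≡m →
      let e+d≡m = trans (+-comm e d) d+e≡m
          balanced′ = balanced (suc d) (s≤s (subst (d ≤_) d+e≡m (m≤m+n d e)))
          end-at : ∀ x → z (x + e + d) ≡ z (x + m)
          end-at x = cong z (trans (+-assoc x e d) (cong (x +_) e+d≡m))
      in ≤-antisym
        (subst (weight p d ≤_) (middle-factor-weight e d (≤-reflexive e+d≡m))
          (balanced-drop (suc d) i (q + e) balanced′ (weight-head zi≡1) (weight-last (trans (end-at q) zj′≡0))))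
        (subst (weight (p + e) d ≤_) (sym (prefix-weights d (subst (d ≤_) d+e≡m (m≤m+n d e))))
          (balanced-drop (suc d) (p + e) j balanced′ (weight-last (trans (end-at p) zi′≡1)) (weight-head zj≡0)))

module SturmianWord (z : Word) (sturmian : Sturmian z) where
  open Factors z

  factors : ∀ d → List (Vec Bool d)
  factors d = proj₁ (sturmian d)

  factors-unique : ∀ d → Unique (factors d)
  factors-unique d = proj₁ (proj₂ (sturmian d))

  factors-length : ∀ d → length (factors d) ≡ suc d
  factors-length d = proj₁ (proj₂ (proj₂ (sturmian d)))

  ∈-factors⁺ : ∀ {d v} → IsFactor z d v → v ∈ factors d
  ∈-factors⁺ {d} {v} = Equivalence.from (proj₂ (proj₂ (proj₂ (sturmian d))) v)

  ∈-factors⁻ : ∀ {d v} → v ∈ factors d → IsFactor z d v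
  ∈-factors⁻ {d} {v} = Equivalence.to (proj₂ (proj₂ (proj₂ (sturmian d))) v)

  ∃-factorAt? : ∀ d {Q : Vec Bool d → Set} → Decidable Q → Dec (∃ λ i → Q (factorAt z i d))
  ∃-factorAt? d Q? with any? Q? (factors d)
  ... | yes any-Q with v , v∈ , q ← find any-Q with i , refl ← ∈-factors⁻ v∈ = yes (i , q)
  ... | no none = no λ (i , q) → none (lose (∈-factors⁺ (i , refl)) q)

  isFactor? : ∀ d v → Dec (IsFactor z d v)
  isFactor? d v = ∃-factorAt? d (λ u → ≡-dec _≟ᵇ_ u v)

  -- Only M of the M + 1 factors of length M can start below M.
  factors-occur-early⇒⊥ : ∀ M → (∀ i → ∃ λ j → j < M × factorAt z i M ≡ factorAt z j M) → ⊥
  factors-occur-early⇒⊥ M early = <⇒≱ (n<1+n M) (begin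
    suc M                             ≡⟨ factors-length M ⟨
    length (factors M)                ≤⟨ unique-⊆⇒length-≤ (factors M) early-factors (factors-unique M) ⊆early ⟩
    length early-factors              ≡⟨ length-applyUpTo (λ j → factorAt z j M) M ⟩
    M                                 ∎)
    where
    open ≤-Reasoning
    early-factors : List (Vec Bool M)
    early-factors = applyUpTo (λ j → factorAt z j M) M
    ⊆early : ∀ v → v ∈ factors M → v ∈ early-factors
    ⊆early v v∈ with i , refl ← ∈-factors⁻ v∈ with j , j<M , eq ← early i =
      subst (_∈ early-factors) (sym eq) (∈-applyUpTo⁺ (λ j → factorAt z j M) j<M)

  eventually-periodic⇒⊥ : ∀ N P → 0 < P → (∀ i → N ≤ i → z (i + P) ≡ z i) → ⊥
  eventually-periodic⇒⊥ N P P>0 periodic = factors-occur-early⇒⊥ (N + P) (<-rec _ occurs-early)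
    where
    M : ℕ
    M = N + P
    shift : ∀ i → N ≤ i → factorAt z (i + P) M ≡ factorAt z i M
    shift i N≤i = factorAt-≡ M (i + P) i λ t _ → begin
      z (i + P + t)  ≡⟨ cong z (trans (+-assoc i P t) (trans (cong (i +_) (+-comm P t)) (sym (+-assoc i t P)))) ⟩
      z (i + t + P)  ≡⟨ periodic (i + t) (≤-trans N≤i (m≤m+n i t)) ⟩
      z (i + t)      ∎
      where open ≡-Reasoning
    P≤ : ∀ {i} → M ≤ i → P ≤ i
    P≤ M≤i = ≤-trans (m≤n+m P N) M≤i
    N≤∸P : ∀ {i} → M ≤ i → N ≤ i ∸ P
    N≤∸P {i} M≤i = subst (_≤ i ∸ P) (m+n∸n≡m N P) (∸-monoˡ-≤ P M≤i)
    occurs-early : ∀ i → (∀ {i′} → i′ < i → ∃ λ j → j < M × factorAt z i′ M ≡ factorAt z j M) →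
                   ∃ λ j → j < M × factorAt z i M ≡ factorAt z j M
    occurs-early i rec with i <? M
    ... | yes i<M = i , i<M , refl
    ... | no i≮M with j , j<M , eq ← rec (∸-monoʳ-< {o = 0} P>0 (P≤ (≮⇒≥ i≮M))) =
      j , j<M , trans (trans (cong (λ x → factorAt z x M) (sym (m∸n+n≡m (P≤ (≮⇒≥ i≮M)))))
                             (shift (i ∸ P) (N≤∸P (≮⇒≥ i≮M)))) eq

  eventually-constant-weight⇒⊥ : ∀ L N c → 0 < L → (∀ i → N ≤ i → weight i L ≡ c) → ⊥
  eventually-constant-weight⇒⊥ L N c L>0 constant = eventually-periodic⇒⊥ N L L>0 λ i N≤i →
    bit-injective (+-cancelʳ-≡ c _ _ (begin
      bit (z (i + L)) + c                 ≡⟨ cong (bit (z (i + L)) +_) (constant i N≤i) ⟨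
      bit (z (i + L)) + weight i L        ≡⟨ weight-last refl ⟨
      weight i (suc L)                    ≡⟨ weight-head refl ⟩
      bit (z i) + weight (suc i) L        ≡⟨ cong (bit (z i) +_) (constant (suc i) (m≤n⇒m≤1+n N≤i)) ⟩
      bit (z i) + c                       ∎))
    where open ≡-Reasoning

  RightSpecial : ∀ d → Vec Bool d → Set
  RightSpecial d u = IsFactor z (suc d) (u ∷ʳ false) × IsFactor z (suc d) (u ∷ʳ true)

  rightSpecial-extension : ∀ {d u} → RightSpecial d u → ∀ b → IsFactor z (suc d) (u ∷ʳ b)
  rightSpecial-extension (u0 , _)  false = u0
  rightSpecial-extension (_  , u1) true  = u1

  distinct-extensions⇒rightSpecial : ∀ {d u b b′} → IsFactor z (suc d) (u ∷ʳ b) → IsFactor z (suc d) (u ∷ʳ b′) →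
                                     b ≢ b′ → RightSpecial d u
  distinct-extensions⇒rightSpecial {b = false} {false} _  _   b≢b′ = ⊥-elim (b≢b′ refl)
  distinct-extensions⇒rightSpecial {b = false} {true}  ub ub′ _    = ub , ub′
  distinct-extensions⇒rightSpecial {b = true}  {false} ub ub′ _    = ub′ , ub
  distinct-extensions⇒rightSpecial {b = true}  {true}  _  _   b≢b′ = ⊥-elim (b≢b′ refl)

  -- Choosing one right extension of every factor of length d and the missing one of two distinct
  -- right special factors yields d + 3 distinct factors of length d + 1.
  rightSpecial-unique : ∀ {d u v} → RightSpecial d u → RightSpecial d v → u ≡ v
  rightSpecial-unique {d} {u} {v} u-special v-special with ≡-dec _≟ᵇ_ u v
  ... | yes u≡v = u≡v
  ... | no u≢v = ⊥-elim (<⇒≱ (n<1+n (suc (suc d))) (begin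
    suc (suc (suc d))          ≡⟨ cong (suc ∘′ suc) (trans (length-map extend (factors d)) (factors-length d)) ⟨
    length longer              ≤⟨ unique-⊆⇒length-≤ longer (factors (suc d)) longer-unique longer⊆ ⟩
    length (factors (suc d))   ≡⟨ factors-length (suc d) ⟩
    suc (suc d)                ∎))
    where
    open ≤-Reasoning
    chosen : Vec Bool d → Bool
    chosen w with isFactor? (suc d) (w ∷ʳ false)
    ... | yes _ = false
    ... | no  _ = true
    extend : Vec Bool d → Vec Bool (suc d)
    extend w = w ∷ʳ chosen w
    extend-factor : ∀ w → IsFactor z d w → IsFactor z (suc d) (extend w)
    extend-factor w (i , refl) with isFactor? (suc d) (w ∷ʳ false) | z (i + d) in zi+d
    ... | yes w0 | _     = w0
    ... | no ¬w0 | false = ⊥-elim (¬w0 (i , trans (factorAt-suc i d) (cong (w ∷ʳ_) zi+d)))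
    ... | no _   | true  = i , trans (factorAt-suc i d) (cong (w ∷ʳ_) zi+d)
    other-∉ : ∀ w y → y ∈ map extend (factors d) → w ∷ʳ not (chosen w) ≢ y
    other-∉ w y y∈ eq with w′ , _ , refl ← ∈-map⁻ extend y∈ with refl , e ← ∷ʳ-injective w w′ eq =
      not-¬ refl (sym e)
    longer : List (Vec Bool (suc d))
    longer = (u ∷ʳ not (chosen u)) ∷ (v ∷ʳ not (chosen v)) ∷ map extend (factors d)
    longer-unique : Unique longer
    longer-unique =
      All.tabulate (λ { (here refl) eq → u≢v (proj₁ (∷ʳ-injective u v eq)) ; (there y∈) → other-∉ u _ y∈ })
      ∷ All.tabulate (other-∉ v _)
      ∷ Unique.map⁺ (λ {x} {y} eq → proj₁ (∷ʳ-injective x y eq)) (factors-unique d)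
    longer⊆ : ∀ x → x ∈ longer → x ∈ factors (suc d)
    longer⊆ _ (here refl)         = ∈-factors⁺ (rightSpecial-extension u-special _)
    longer⊆ _ (there (here refl)) = ∈-factors⁺ (rightSpecial-extension v-special _)
    longer⊆ _ (there (there x∈)) with w , w∈ , refl ← ∈-map⁻ extend x∈ =
      ∈-factors⁺ (extend-factor w (∈-factors⁻ w∈))

  repeated-window : ∀ m K → ∃₂ λ t₁ t₂ → t₁ < t₂ × t₂ < suc (suc m) × factorAt z (K + t₁) m ≡ factorAt z (K + t₂) m
  repeated-window m K = pigeonhole (λ t → factorAt z (K + t) m) (factors m) (λ t _ → ∈-factors⁺ (K + t , refl))
                                   (≤-reflexive (cong suc (factors-length m)))

  eventually-right-determined⇒⊥ : ∀ m x₀ →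
    (∀ x y → x₀ ≤ x → x₀ ≤ y → factorAt z x m ≡ factorAt z y m → z (x + m) ≡ z (y + m)) → ⊥
  eventually-right-determined⇒⊥ m x₀ determined
    with t₁ , t₂ , t₁<t₂ , _ , same ← repeated-window m x₀ =
    eventually-periodic⇒⊥ (a + m) P (m<n⇒0<n∸m t₁<t₂)
      (repeat⇒periodic m a P (subst (λ x → factorAt z a m ≡ factorAt z x m) a+P≡ same) λ s →
        determined (a + s) (a + P + s) (≤-trans (m≤m+n x₀ t₁) (m≤m+n a s))
                   (≤-trans (m≤m+n x₀ t₁) (≤-trans (m≤m+n a P) (m≤m+n (a + P) s))))
    where
    a P : ℕ
    a = x₀ + t₁
    P = t₂ ∸ t₁
    a+P≡ : x₀ + t₂ ≡ a + P
    a+P≡ = trans (cong (x₀ +_) (sym (m+[n∸m]≡n (<⇒≤ t₁<t₂)))) (sym (+-assoc x₀ t₁ P))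

  right-extension-unique : ∀ m a b → factorAt z a m ≡ factorAt z b m → ¬ RightSpecial m (factorAt z a m) →
                           z (a + m) ≡ z (b + m)
  right-extension-unique m a b same ¬special with z (a + m) ≟ᵇ z (b + m)
  ... | yes eq = eq
  ... | no neq = ⊥-elim (¬special (distinct-extensions⇒rightSpecial
          (a , factorAt-suc a m) (b , trans (factorAt-suc b m) (cong (_∷ʳ z (b + m)) (sym same))) neq))

  module Palindrome-0w0-1w1
    (m i j : ℕ)
    (zi≡1 : z i ≡ true) (zi′≡1 : z (suc i + m) ≡ true)
    (zj≡0 : z j ≡ false) (zj′≡0 : z (suc j + m) ≡ false)
    (same-middle : factorAt z (suc j) m ≡ factorAt z (suc i) m)
    (palindrome : ∀ t e → suc t + e ≡ m → z (suc i + t) ≡ z (suc i + e))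
    where

    w : Vec Bool m
    w = factorAt z (suc i) m

    Occ : ℕ → Set
    Occ k = factorAt z k m ≡ w

    occ? : Decidable Occ
    occ? k = ≡-dec _≟ᵇ_ (factorAt z k m) w

    w-rightSpecial : RightSpecial m w
    w-rightSpecial = (suc j , trans (factorAt-suc (suc j) m) (cong₂ _∷ʳ_ same-middle zj′≡0))
                   , (suc i , trans (factorAt-suc (suc i) m) (cong (w ∷ʳ_) zi′≡1))

    determined : ∀ a b → factorAt z a m ≡ factorAt z b m → ¬ Occ a → z (a + m) ≡ z (b + m)
    determined a b same ¬occ =
      right-extension-unique m a b same λ special → ¬occ (rightSpecial-unique special w-rightSpecial)

    -- Away from w the windows move deterministically, so a window repeated between two
    -- occurrences of w would reach the later occurrence too early.
    no-long-gap : ∀ K K′ → Occ K → Occ K′ → (∀ y → K < y → y < K′ → ¬ Occ y) → K + suc (suc m) ≤ K′ → ⊥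
    no-long-gap K K′ occK occK′ none far with repeated-window m K
    ... | zero , t₂ , 0<t₂ , t₂<2+m , same =
      none (K + t₂) (m<m+n K 0<t₂) (<-≤-trans (+-monoʳ-< K t₂<2+m) far)
           (trans (sym same) (trans (cong (λ x → factorAt z x m) (+-identityʳ K)) occK))
    ... | suc t₁ , t₂ , t₁<t₂ , t₂<2+m , same =
      none (a + L) (<-≤-trans K<a (m≤m+n a L)) a+L<K′
           (trans (factorAt-steps same L λ s s<L same′ →
                     determined (a + s) (b + s) same′
                                (none (a + s) (<-≤-trans K<a (m≤m+n a s)) (<-trans (+-monoʳ-< a s<L) a+L<K′)))
                  (trans (cong (λ x → factorAt z x m) b+L≡K′) occK′))
      where
      a b L : ℕ
      a = K + suc t₁
      b = K + t₂
      L = K′ ∸ b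
      K<a : K < a
      K<a = m<m+n K z<s
      b+L≡K′ : b + L ≡ K′
      b+L≡K′ = m+[n∸m]≡n (≤-trans (+-monoʳ-≤ K (<⇒≤ t₂<2+m)) far)
      a+L<K′ : a + L < K′
      a+L<K′ = subst (a + L <_) b+L≡K′ (+-monoˡ-< L (+-monoʳ-< K t₁<t₂))

    occurrence-gap : ∀ K K′ → Occ K → Occ K′ → (∀ y → K < y → y < K′ → ¬ Occ y) → K′ ≤ K + suc m
    occurrence-gap K K′ occK occK′ none with K′ ≤? K + suc m
    ... | yes close = close
    ... | no far = ⊥-elim (no-long-gap K K′ occK occK′ none (subst (_≤ K′) (sym (+-suc K (suc m))) (≰⇒> far)))

    -- Since w is a palindrome, the letter before an occurrence of w overlapping an earlier one
    -- equals the letter after the earlier one.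
    overlap-letter : ∀ Y t → t ≤ m → Occ Y → Occ (suc (Y + t)) → z (Y + t) ≡ z (Y + m)
    overlap-letter Y t t≤m occY occ′ with m≤n⇒m<n∨m≡n t≤m
    ... | inj₂ refl = refl
    ... | inj₁ t<m = begin
      z (Y + t)              ≡⟨ factorAt-≡⁻ m Y (suc i) occY t t<m ⟩
      z (suc i + t)          ≡⟨ palindrome t e t+e≡m ⟩
      z (suc i + e)          ≡⟨ factorAt-≡⁻ m (suc (Y + t)) (suc i) occ′ e e<m ⟨
      z (suc (Y + t) + e)    ≡⟨ cong z shifted ⟩
      z (Y + m)              ∎
      where
      open ≡-Reasoning
      e : ℕ
      e = m ∸ suc t
      t+e≡m : suc t + e ≡ m
      t+e≡m = m+[n∸m]≡n t<m
      e<m : e < m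
      e<m = subst (e <_) t+e≡m (m<n+m e z<s)
      shifted : suc (Y + t) + e ≡ Y + m
      shifted = trans (cong suc (+-assoc Y t e)) (trans (sym (+-suc Y (t + e))) (cong (Y +_) t+e≡m))

    -- If c w ¬c never occurred, every occurrence of w after x₀ would be flanked by c on both
    -- sides, so all right extensions after x₀ would be determined.
    module Flanked (c : Bool) (x₀ : ℕ) (zx₀≡c : z x₀ ≡ c) (occ₀ : Occ (suc x₀)) where

      c-w-¬c : IsFactor z (suc (suc m)) (c ∷ (w ∷ʳ not c))
      c-w-¬c with isFactor? (suc (suc m)) (c ∷ (w ∷ʳ not c))
      ... | yes found  = found
      ... | no missing = ⊥-elim (eventually-right-determined⇒⊥ m (suc x₀) determined-after)
        where
        followed : ∀ x → Occ (suc x) → z x ≡ c → z (suc x + m) ≡ c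
        followed x occ zx≡c with z (suc x + m) ≟ᵇ c
        ... | yes eq  = eq
        ... | no  neq = ⊥-elim (missing (x , cong₂ _∷_ zx≡c
                          (trans (factorAt-suc (suc x) m) (cong₂ _∷ʳ_ occ (¬-not neq)))))

        preceded : ∀ x → (∀ {y} → y < x → x₀ ≤ y → Occ (suc y) → z y ≡ c) → x₀ ≤ x → Occ (suc x) → z x ≡ c
        preceded x rec x₀≤x occ with m≤n⇒m<n∨m≡n x₀≤x
        ... | inj₂ refl = zx₀≡c
        ... | inj₁ x₀<x with y , x₀≤y , y<x , occy , none ← last-before (λ y → occ? (suc y)) x₀<x occ₀ = begin
          z x              ≡⟨ cong z y+t≡x ⟨
          z (suc y + t)    ≡⟨ overlap-letter (suc y) t t≤m occy (subst (λ k → Occ (suc k)) (sym y+t≡x) occ) ⟩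
          z (suc y + m)    ≡⟨ followed y occy (rec y<x x₀≤y occy) ⟩
          c                ∎
          where
          open ≡-Reasoning
          t : ℕ
          t = x ∸ suc y
          y+t≡x : suc y + t ≡ x
          y+t≡x = m+[n∸m]≡n y<x
          close : suc x ≤ suc y + suc m
          close = occurrence-gap (suc y) (suc x) occy occ λ { (suc y′) y<y′ y′<x → none y′ (≤-pred y<y′) (≤-pred y′<x) }
          t≤m : t ≤ m
          t≤m = +-cancelˡ-≤ (suc y) t m (≤-pred (subst₂ _≤_ (cong suc (sym y+t≡x)) (+-suc (suc y) m) close))

        determined-after : ∀ a b → suc x₀ ≤ a → suc x₀ ≤ b → factorAt z a m ≡ factorAt z b m → z (a + m) ≡ z (b + m)
        determined-after (suc a) (suc b) (s≤s x₀≤a) (s≤s x₀≤b) same with occ? (suc a)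
        ... | no ¬occ = determined (suc a) (suc b) same ¬occ
        ... | yes occa = trans (followed a occa (<-rec _ preceded a x₀≤a occa))
                               (sym (followed b occb (<-rec _ preceded b x₀≤b occb)))
          where
          occb : Occ (suc b)
          occb = trans (sym same) occa

    0w-rightSpecial : RightSpecial (suc m) (false ∷ w)
    0w-rightSpecial = (j , cong₂ _∷_ zj≡0 (trans (factorAt-suc (suc j) m) (cong₂ _∷ʳ_ same-middle zj′≡0)))
                    , Flanked.c-w-¬c false j zj≡0 same-middle

    1w-rightSpecial : RightSpecial (suc m) (true ∷ w)
    1w-rightSpecial = Flanked.c-w-¬c true i zi≡1 refl
                    , (i , cong₂ _∷_ zi≡1 (trans (factorAt-suc (suc i) m) (cong (w ∷ʳ_) zi′≡1)))

    absurd : ⊥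
    absurd with () ← proj₁ (∷-injective (rightSpecial-unique 0w-rightSpecial 1w-rightSpecial))

  unbalanced⇒⊥ : ∀ d → (∀ d′ → d′ < d → Balanced d′) → ∀ i j → suc (suc (weight j d)) ≤ weight i d → ⊥
  unbalanced⇒⊥ 0             _     i j ()
  unbalanced⇒⊥ 1             _     i j ub = <⇒≱ ub (≤-trans (weight≤length i 1) (s≤s z≤n))
  unbalanced⇒⊥ (suc (suc m)) below i j ub =
    Palindrome-0w0-1w1.absurd m i j zi≡1 zi′≡1 zj≡0 zj′≡0 same-middle palindrome
    where open MinimalUnbalanced m i j (λ d d≤1+m → below d (s≤s d≤1+m)) ub

  balanced : ∀ d → Balanced d
  balanced = <-rec Balanced λ d below i j → case weight i d ≤? suc (weight j d) of λ
    { (yes ok) → ok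
    ; (no ¬ok) → ⊥-elim (unbalanced⇒⊥ d (λ d′ d′<d → below d′<d) i j (≰⇒> ¬ok)) }

  two-weights : ∀ n → 0 < n → ∃₂ λ a b → weight b n ≡ suc (weight a n)
  two-weights n 0<n with ∃-factorAt? n {λ v → count1 v ≢ weight 0 n} (λ v → ¬? (count1 v ≟ weight 0 n))
  ... | no none = ⊥-elim (eventually-constant-weight⇒⊥ n 0 (weight 0 n) 0<n λ i _ →
                    decidable-stable (weight i n ≟ weight 0 n) (λ wi≢w0 → none (i , wi≢w0)))
  ... | yes (j , wj≢w0) with <-cmp (weight j n) (weight 0 n)
  ...   | tri< wj<w0 _ _ = j , 0 , ≤-antisym (balanced n 0 j) wj<w0
  ...   | tri≈ _ wj≡w0 _ = ⊥-elim (wj≢w0 wj≡w0)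
  ...   | tri> _ _ w0<wj = 0 , j , ≤-antisym (balanced n j 0) w0<wj

  weight-levels : ∀ n a b → weight b n ≡ suc (weight a n) → ∀ i → ∃ λ h → weight i n ≡ weight a n + bit h
  weight-levels n a b wb≡1+wa i with m≤n⇒m<n∨m≡n (balanced n i a)
  ... | inj₂ wi≡1+wa = true , trans wi≡1+wa (+-comm 1 (weight a n))
  ... | inj₁ wi≤wa = false , trans (≤-antisym (≤-pred wi≤wa) wa≤wi) (sym (+-identityʳ (weight a n)))
    where
    wa≤wi : weight a n ≤ weight i n
    wa≤wi = ≤-pred (subst (_≤ suc (weight i n)) wb≡1+wa (balanced n b i))

  two-levels : ∀ n → 0 < n →
    ∃ λ k → (∀ i → ∃ λ h → weight i n ≡ k + bit h) × (∀ h → ∃ λ a → weight a n ≡ k + bit h)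
  two-levels n 0<n with a , b , wb≡1+wa ← two-weights n 0<n =
    weight a n , weight-levels n a b wb≡1+wa ,
    λ { false → a , sym (+-identityʳ (weight a n)) ; true → b , trans wb≡1+wa (+-comm 1 (weight a n)) }

-- The edges of an abelian Rauzy graph whose vertices are two weight levels, 0 (lower) and
-- 1 (upper): rise goes up with label (0,1), fall goes down with label (1,0), and loop h c stays
-- at level h with label (c,c); the loop is diagonal if c = h and off-diagonal otherwise.
data Kind : Set where
  rise fall : Kind
  loop      : Bool → Bool → Kind

source target first last : Kind → Bool
source rise       = false
source fall       = true
source (loop h _) = h
target rise       = true
target fall       = false
target (loop h _) = h
first rise        = false
first fall        = true
first (loop _ c)  = c
last rise         = true
last fall         = false
last (loop _ c)   = c

-- A step from level h to level h′ reading a first and b last letter changes the weight by b - a.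
kind : ∀ h h′ a b → bit h + bit b ≡ bit a + bit h′ →
       Σ Kind λ κ → source κ ≡ h × target κ ≡ h′ × first κ ≡ a × last κ ≡ b
kind false false false false _ = loop false false , refl , refl , refl , refl
kind false false false true  ()
kind false false true  false ()
kind false false true  true  _ = loop false true , refl , refl , refl , refl
kind false true  false false ()
kind false true  false true  _ = rise , refl , refl , refl , refl
kind false true  true  false ()
kind false true  true  true  ()
kind true  false false false ()
kind true  false false true  ()
kind true  false true  false _ = fall , refl , refl , refl , refl
kind true  false true  true  ()
kind true  true  false false _ = loop true false , refl , refl , refl , refl
kind true  true  false true  ()
kind true  true  true  false ()
kind true  true  true  true  _ = loop true true , refl , refl , refl , refl

switch : Bool → Kind
switch false = rise
switch true  = fall

target-unless-switch : ∀ κ → κ ≢ switch (source κ) → target κ ≡ source κ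
target-unless-switch rise       ≢rise = ⊥-elim (≢rise refl)
target-unless-switch fall       ≢fall = ⊥-elim (≢fall refl)
target-unless-switch (loop _ _) _     = refl

diagonal≢offDiagonal : ∀ {d o} → loop d d ≢ loop o (not o)
diagonal≢offDiagonal {false} {false} ()
diagonal≢offDiagonal {false} {true}  ()
diagonal≢offDiagonal {true}  {false} ()
diagonal≢offDiagonal {true}  {true}  ()

kind-injective : ∀ {κ κ′} → source κ ≡ source κ′ → first κ ≡ first κ′ → last κ ≡ last κ′ → κ ≡ κ′
kind-injective {rise}     {rise}     _    _    _  = refl
kind-injective {rise}     {fall}     ()   _    _
kind-injective {rise}     {loop _ _} refl refl ()
kind-injective {fall}     {rise}     ()   _    _
kind-injective {fall}     {fall}     _    _    _  = refl
kind-injective {fall}     {loop _ _} refl refl ()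
kind-injective {loop _ _} {rise}     refl refl ()
kind-injective {loop _ _} {fall}     refl refl ()
kind-injective {loop _ _} {loop _ _} refl refl _  = refl

module AbelianRauzyGraph (z : Word) (sturmian : Sturmian z) (n′ : ℕ) where

  open Factors z
  open SturmianWord z sturmian

  n : ℕ
  n = suc n′

  k : ℕ
  k = proj₁ (two-levels n z<s)

  level-of : ∀ i → ∃ λ h → weight i n ≡ k + bit h
  level-of = proj₁ (proj₂ (two-levels n z<s))

  at-level : ∀ h → ∃ λ a → weight a n ≡ k + bit h
  at-level = proj₂ (proj₂ (two-levels n z<s))

  level : Bool → ℕ × ℕ
  level h = ψ n (k + bit h)

  level-injective : ∀ {h h′} → level h ≡ level h′ → h ≡ h′
  level-injective eq = bit-injective (+-cancelˡ-≡ k _ _ (Product.,-injectiveʳ eq))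

  ⟦_⟧ : Kind → Edge
  ⟦ κ ⟧ = level (source κ) , (first κ , last κ) , level (target κ)

  ⟦⟧-injective : ∀ {κ κ′} → ⟦ κ ⟧ ≡ ⟦ κ′ ⟧ → κ ≡ κ′
  ⟦⟧-injective eq with src , rest ← Product.,-injective eq with a , b ← Product.,-injective (Product.,-injectiveˡ rest) =
    kind-injective (level-injective src) a b

  edgeAt : ℕ → Edge
  edgeAt i = Ψ (factorAt z i n) , (z i , z (i + n)) , Ψ (factorAt z (suc i) n)

  isEdge⇔edgeAt : ∀ {e} → IsEdge z n e ⇔ (∃ λ i → edgeAt i ≡ e)
  isEdge⇔edgeAt = mk⇔ (λ (i , x , y , a , b) → i , cong₂ _,_ x (cong₂ _,_ (cong₂ _,_ a b) y))
                      (λ { (i , refl) → i , refl , refl , refl , refl })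

  level-step : ∀ i {h h′} → weight i n ≡ k + bit h → weight (suc i) n ≡ k + bit h′ →
              bit h + bit (z (i + n)) ≡ bit (z i) + bit h′
  level-step i {h} {h′} wi wi′ = +-cancelˡ-≡ k _ _ (begin
    k + (bit h + bit (z (i + n)))     ≡⟨ solve 3 (λ k h b → k :+ (h :+ b) := b :+ (k :+ h)) refl k (bit h) (bit (z (i + n))) ⟩
    bit (z (i + n)) + (k + bit h)     ≡⟨ cong (bit (z (i + n)) +_) wi ⟨
    bit (z (i + n)) + weight i n      ≡⟨ weight-last refl ⟨
    weight i (suc n)                  ≡⟨ weight-head refl ⟩
    bit (z i) + weight (suc i) n      ≡⟨ cong (bit (z i) +_) wi′ ⟩
    bit (z i) + (k + bit h′)          ≡⟨ solve 3 (λ k a h′ → a :+ (k :+ h′) := k :+ (a :+ h′)) refl k (bit (z i)) (bit h′) ⟩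
    k + (bit (z i) + bit h′)          ∎)
    where open ≡-Reasoning

  kindAt : ∀ i → Σ Kind λ κ → edgeAt i ≡ ⟦ κ ⟧
  kindAt i with h , wi ← level-of i | h′ , wi′ ← level-of (suc i)
    with κ , refl , refl , a , b ← kind h h′ (z i) (z (i + n)) (level-step i wi wi′) =
    κ , cong₂ _,_ (trans (Ψ≡ψ (factorAt z i n)) (cong (ψ n) wi))
                  (cong₂ _,_ (cong₂ _,_ (sym a) (sym b)) (trans (Ψ≡ψ (factorAt z (suc i) n)) (cong (ψ n) wi′)))

  module _ {i} κ (eq : edgeAt i ≡ ⟦ κ ⟧) where

    source-weight : weight i n ≡ k + bit (source κ)
    source-weight = cong (proj₂ ∘ proj₁) eq

    target-weight : weight (suc i) n ≡ k + bit (target κ)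
    target-weight = cong (proj₂ ∘ proj₂ ∘ proj₂) eq

    first-letter : z i ≡ first κ
    first-letter = cong (proj₁ ∘ proj₁ ∘ proj₂) eq

    last-letter : z (i + n) ≡ last κ
    last-letter = cong (proj₂ ∘ proj₁ ∘ proj₂) eq

    longer-weight : weight i (suc n) ≡ bit (last κ) + (k + bit (source κ))
    longer-weight = trans (weight-last last-letter) (cong (bit (last κ) +_) source-weight)

    shorter-weight : bit (first κ) + weight (suc i) n′ ≡ k + bit (source κ)
    shorter-weight = trans (sym (weight-head first-letter)) source-weight

  Present : Kind → Set
  Present κ = IsEdge z n ⟦ κ ⟧

  present-at : ∀ κ {i} → edgeAt i ≡ ⟦ κ ⟧ → Present κ
  present-at κ {i} eq = Equivalence.from (isEdge⇔edgeAt {⟦ κ ⟧}) (i , eq)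

  occurrence : ∀ κ → Present κ → ∃ λ i → edgeAt i ≡ ⟦ κ ⟧
  occurrence κ = Equivalence.to (isEdge⇔edgeAt {⟦ κ ⟧})

  edge-kind : ∀ {e} → IsEdge z n e → ∃ λ κ → Present κ × ⟦ κ ⟧ ≡ e
  edge-kind {e} ie =
    let i , eᵢ = Equivalence.to (isEdge⇔edgeAt {e}) ie
        κ , κᵢ = kindAt i
    in κ , present-at κ κᵢ , trans (sym κᵢ) eᵢ

  edge-≟ : DecidableEquality Edge
  edge-≟ = Product.≡-dec vertex-≟ (Product.≡-dec (Product.≡-dec _≟ᵇ_ _≟ᵇ_) vertex-≟)
    where
    vertex-≟ : DecidableEquality (ℕ × ℕ)
    vertex-≟ = Product.≡-dec _≟_ _≟_

  edgeOf : Vec Bool (suc n) → Edge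
  edgeOf v = Ψ (Vec.init v) , (Vec.head v , Vec.last v) , Ψ (Vec.tail v)

  edgeOf-factorAt : ∀ i → edgeOf (factorAt z i (suc n)) ≡ edgeAt i
  edgeOf-factorAt i = cong₂ _,_
    (cong Ψ (trans (cong Vec.init (factorAt-suc i n)) (init-∷ʳ (z (i + n)) (factorAt z i n))))
    (cong₂ _,_ (cong (z i ,_) (trans (cong Vec.last (factorAt-suc i n)) (last-∷ʳ (z (i + n)) (factorAt z i n)))) refl)

  present? : Decidable Present
  present? κ with ∃-factorAt? (suc n) (λ v → edge-≟ (edgeOf v) ⟦ κ ⟧)
  ... | yes (i , eq) = yes (present-at κ (trans (sym (edgeOf-factorAt i)) eq))
  ... | no none = no λ p → let i , eq = occurrence κ p in none (i , trans (edgeOf-factorAt i) eq)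

  ≢-absent : ∀ {i} κ {κ′} → edgeAt i ≡ ⟦ κ ⟧ → ¬ Present κ′ → κ ≢ κ′
  ≢-absent κ eq ¬present κ≡κ′ = ¬present (subst Present κ≡κ′ (present-at κ eq))

  upper≰lower : ¬ k + bit true ≤ k + bit false
  upper≰lower k+1≤k+0 with () ← +-cancelˡ-≤ k 1 0 k+1≤k+0

  stay-on-level : ∀ h i → ¬ Present (switch h) → weight i n ≡ k + bit h → weight (suc i) n ≡ k + bit h
  stay-on-level h i ¬switch wi =
    let κ , eq = kindAt i
        source≡h = bit-injective (+-cancelˡ-≡ k _ _ (trans (sym (source-weight κ eq)) wi))
        stays = target-unless-switch κ (≢-absent κ eq (subst (λ h → ¬ Present (switch h)) (sym source≡h) ¬switch))
    in trans (target-weight κ eq) (cong (λ h → k + bit h) (trans stays source≡h))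

  -- Otherwise the weight would stay on the level h from a first window of that weight on.
  switch-present : ∀ h → Present (switch h)
  switch-present h with present? (switch h)
  ... | yes present = present
  ... | no ¬switch = ⊥-elim (eventually-constant-weight⇒⊥ n a (k + bit h) z<s λ i a≤i →
                       subst (λ x → weight x n ≡ k + bit h) (m+[n∸m]≡n a≤i) (stays (i ∸ a)))
    where
    a : ℕ
    a = proj₁ (at-level h)
    stays : ∀ s → weight (a + s) n ≡ k + bit h
    stays zero    = trans (cong (λ x → weight x n) (+-identityʳ a)) (proj₂ (at-level h))
    stays (suc s) = trans (cong (λ x → weight x n) (+-suc a s)) (stay-on-level h (a + s) ¬switch (stays s))

  steady-longer : ∀ κ → κ ≢ loop false false → κ ≢ loop true true → bit (last κ) + (k + bit (source κ)) ≡ suc k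
  steady-longer rise              _ _ = cong suc (+-identityʳ k)
  steady-longer fall              _ _ = +-comm k 1
  steady-longer (loop false false) ≢ff _ = ⊥-elim (≢ff refl)
  steady-longer (loop false true)  _ _ = cong suc (+-identityʳ k)
  steady-longer (loop true false)  _ _ = +-comm k 1
  steady-longer (loop true true)   _ ≢tt = ⊥-elim (≢tt refl)

  steady-shorter : ∀ κ → κ ≢ loop false true → κ ≢ loop true false →
                   ∀ {w} → bit (first κ) + w ≡ k + bit (source κ) → w ≡ k
  steady-shorter rise               _ _ eq = trans eq (+-identityʳ k)
  steady-shorter fall               _ _ eq = cong pred (trans eq (+-comm k 1))
  steady-shorter (loop false false) _ _ eq = trans eq (+-identityʳ k)
  steady-shorter (loop false true)  ≢ft _ _ = ⊥-elim (≢ft refl)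
  steady-shorter (loop true false)  _ ≢tf _ = ⊥-elim (≢tf refl)
  steady-shorter (loop true true)   _ _ eq = cong pred (trans eq (+-comm k 1))

  diagonals-exclusive : Present (loop false false) → Present (loop true true) → ⊥
  diagonals-exclusive p q with i , eqᵢ ← occurrence (loop false false) p | j , eqⱼ ← occurrence (loop true true) q =
    upper≰lower (≤-pred (subst₂ _≤_ (longer-weight (loop true true) eqⱼ)
                                    (cong suc (longer-weight (loop false false) eqᵢ))
                                    (balanced (suc n) j i)))

  -- Without diagonal loops every window of length n + 1 would have weight k + 1.
  diagonal : ∃ λ d → Present (loop d d) × ¬ Present (loop (not d) (not d))
  diagonal with present? (loop false false) | present? (loop true true)
  ... | yes p  | _     = false , p , diagonals-exclusive p
  ... | no ¬p  | yes q = true , q , ¬p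
  ... | no ¬p  | no ¬q = ⊥-elim (eventually-constant-weight⇒⊥ (suc n) 0 (suc k) z<s λ i _ →
    let κ , eq = kindAt i in
    trans (longer-weight κ eq) (steady-longer κ (≢-absent κ eq ¬p) (≢-absent κ eq ¬q)))

  offDiagonals-exclusive : Present (loop false true) → Present (loop true false) → ⊥
  offDiagonals-exclusive p q with i , eqᵢ ← occurrence (loop false true) p | j , eqⱼ ← occurrence (loop true false) q =
    upper≰lower (subst₂ _≤_ (shorter-weight (loop true false) eqⱼ) (shorter-weight (loop false true) eqᵢ)
                            (balanced n′ (suc j) (suc i)))

  -- Without off-diagonal loops every window of length n - 1 after the first would have weight k.
  offDiagonal-present : 0 < n′ → ∃ λ o → Present (loop o (not o))
  offDiagonal-present 0<n′ with present? (loop false true) | present? (loop true false)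
  ... | yes p  | _     = false , p
  ... | no _   | yes q = true , q
  ... | no ¬p  | no ¬q = ⊥-elim (eventually-constant-weight⇒⊥ n′ 1 k 0<n′ λ { (suc i) _ →
    let κ , eq = kindAt i in
    steady-shorter κ (≢-absent κ eq ¬p) (≢-absent κ eq ¬q) (shorter-weight κ eq) })

  offDiagonal-absent : n′ ≡ 0 → ∀ o → ¬ Present (loop o (not o))
  offDiagonal-absent refl false p with i , eq ← occurrence (loop false true) p =
    upper≰lower (subst₂ _≤_ (proj₂ (at-level true)) (shorter-weight (loop false true) eq)
                            (weight≤length (proj₁ (at-level true)) 1))
  offDiagonal-absent refl true  p with i , eq ← occurrence (loop true false) p
    with () ← trans (shorter-weight (loop true false) eq) (+-comm k 1)

  offDiagonal-unique : ∀ {h o} → Present (loop h (not h)) → Present (loop o (not o)) → h ≡ o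
  offDiagonal-unique {false} {false} _ _ = refl
  offDiagonal-unique {false} {true}  p q = ⊥-elim (offDiagonals-exclusive p q)
  offDiagonal-unique {true}  {false} p q = ⊥-elim (offDiagonals-exclusive q p)
  offDiagonal-unique {true}  {true}  _ _ = refl

  kinds-hasSize : ∀ {B : Set} {Q : B → Set} (f : Kind → B) → (∀ c → (∃ λ κ → Present κ × f κ ≡ c) ⇔ Q c) →
                  ∀ ks → Unique (map f ks) → All Present ks → (∀ κ → Present κ → f κ ∈ map f ks) →
                  HasSize Q (length ks)
  kinds-hasSize f f⇔Q ks unique present complete = HasSize-⇔ f⇔Q (image-hasSize f ks unique present complete)

  isEdge⇔ : ∀ e → (∃ λ κ → Present κ × ⟦ κ ⟧ ≡ e) ⇔ IsEdge z n e
  isEdge⇔ e = mk⇔ (λ { (κ , p , refl) → p }) edge-kind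

  rClass : Edge → (ℕ × ℕ) × Bool
  rClass (x , (_ , b) , _) = x , b

  lClass : Edge → Bool × (ℕ × ℕ)
  lClass (_ , (a , _) , y) = a , y

  offDiagonal-rClass : ∀ h → rClass ⟦ loop h (not h) ⟧ ≡ rClass ⟦ switch h ⟧
  offDiagonal-rClass false = refl
  offDiagonal-rClass true  = refl

  offDiagonal-lClass : ∀ h → lClass ⟦ loop h (not h) ⟧ ≡ lClass ⟦ switch (not h) ⟧
  offDiagonal-lClass false = refl
  offDiagonal-lClass true  = refl

  isRClass⇔ : ∀ c → (∃ λ κ → Present κ × rClass ⟦ κ ⟧ ≡ c) ⇔ IsRClass z n c
  isRClass⇔ c = mk⇔ (λ { (κ , p , refl) → first κ , level (target κ) , p })
                    (λ (_ , _ , ie) → let κ , p , eq = edge-kind ie in κ , p , cong rClass eq)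

  isLClass⇔ : ∀ c → (∃ λ κ → Present κ × lClass ⟦ κ ⟧ ≡ c) ⇔ IsLClass z n c
  isLClass⇔ c = mk⇔ (λ { (κ , p , refl) → level (source κ) , last κ , p })
                    (λ (_ , _ , ie) → let κ , p , eq = edge-kind ie in κ , p , cong lClass eq)

  rClass-≢ : ∀ {h h′ c c′ : Bool} → (h , c) ≢ (h′ , c′) → (level h , c) ≢ (level h′ , c′)
  rClass-≢ ne eq with src , b ← Product.,-injective eq = ne (cong₂ _,_ (level-injective src) b)

  lClass-≢ : ∀ {h h′ c c′ : Bool} → (c , h) ≢ (c′ , h′) → (c , level h) ≢ (c′ , level h′)
  lClass-≢ ne eq with a , tgt ← Product.,-injective eq = ne (cong₂ _,_ a (level-injective tgt))

  rClasses-unique : ∀ d → Unique (map (rClass ∘ ⟦_⟧) (rise ∷ fall ∷ loop d d ∷ []))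
  rClasses-unique d = (rClass-≢ (λ ()) ∷ rClass-≢ (λ ()) ∷ [])
                    ∷ (rClass-≢ (λ ()) ∷ []) ∷ [] ∷ []

  lClasses-unique : ∀ d → Unique (map (lClass ∘ ⟦_⟧) (rise ∷ fall ∷ loop d d ∷ []))
  lClasses-unique d = (lClass-≢ (λ ()) ∷ lClass-≢ (λ ()) ∷ [])
                    ∷ (lClass-≢ (λ ()) ∷ []) ∷ [] ∷ []

  module WithDiagonal (d : Bool) (diagonal-present : Present (loop d d))
                      (other-absent : ¬ Present (loop (not d) (not d))) where

    diagonal-unique : ∀ h → Present (loop h h) → h ≡ d
    diagonal-unique h p with h ≟ᵇ d
    ... | yes h≡d = h≡d
    ... | no  h≢d = ⊥-elim (other-absent (subst (λ h → Present (loop h h)) (¬-not h≢d) p))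

    base : List Kind
    base = rise ∷ fall ∷ loop d d ∷ []

    base-present : All Present base
    base-present = switch-present false ∷ switch-present true ∷ diagonal-present ∷ []

    switch∈base : ∀ h → switch h ∈ base
    switch∈base false = here refl
    switch∈base true  = there (here refl)

    present-kind : ∀ κ → Present κ → κ ∈ base ⊎ ∃ λ h → κ ≡ loop h (not h)
    present-kind rise       _ = inj₁ (here refl)
    present-kind fall       _ = inj₁ (there (here refl))
    present-kind (loop h c) p with c ≟ᵇ h
    ... | yes refl = inj₁ (there (there (here (cong₂ loop (diagonal-unique h p) (diagonal-unique h p)))))
    ... | no  c≢h  = inj₂ (h , cong (loop h) (¬-not c≢h))

    edges-without-offDiagonal : (∀ o → ¬ Present (loop o (not o))) → HasSize (IsEdge z n) 3
    edges-without-offDiagonal absent = kinds-hasSize ⟦_⟧ isEdge⇔ base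
      (Unique.map⁺ ⟦⟧-injective {base} (((λ ()) ∷ (λ ()) ∷ []) ∷ ((λ ()) ∷ []) ∷ [] ∷ []))
      base-present complete
      where
      complete : ∀ κ → Present κ → ⟦ κ ⟧ ∈ map ⟦_⟧ base
      complete κ p with present-kind κ p
      ... | inj₁ κ∈base    = ∈-map⁺ ⟦_⟧ κ∈base
      ... | inj₂ (h , refl) = ⊥-elim (absent h p)

    edges-with-offDiagonal : ∀ o → Present (loop o (not o)) → HasSize (IsEdge z n) 4
    edges-with-offDiagonal o off = kinds-hasSize ⟦_⟧ isEdge⇔ kinds
      (Unique.map⁺ ⟦⟧-injective {kinds}
        (((λ ()) ∷ (λ ()) ∷ (λ ()) ∷ []) ∷ ((λ ()) ∷ (λ ()) ∷ []) ∷ (diagonal≢offDiagonal ∷ []) ∷ [] ∷ []))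
      (++⁺ base-present (off ∷ [])) complete
      where
      kinds : List Kind
      kinds = base ++ loop o (not o) ∷ []
      complete : ∀ κ → Present κ → ⟦ κ ⟧ ∈ map ⟦_⟧ kinds
      complete κ p = ∈-map⁺ ⟦_⟧ {xs = kinds} (case present-kind κ p of λ
        { (inj₁ κ∈base)    → ∈-++⁺ˡ κ∈base
        ; (inj₂ (h , refl)) → there (there (there (here (cong (λ h → loop h (not h)) (offDiagonal-unique p off))))) })

    rClasses : HasSize (IsRClass z n) 3
    rClasses = kinds-hasSize (rClass ∘ ⟦_⟧) isRClass⇔ base (rClasses-unique d) base-present complete
      where
      complete : ∀ κ → Present κ → rClass ⟦ κ ⟧ ∈ map (rClass ∘ ⟦_⟧) base
      complete κ p with present-kind κ p
      ... | inj₁ κ∈base    = ∈-map⁺ (rClass ∘ ⟦_⟧) κ∈base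
      ... | inj₂ (h , refl) = subst (_∈ map (rClass ∘ ⟦_⟧) base) (sym (offDiagonal-rClass h))
                                    (∈-map⁺ (rClass ∘ ⟦_⟧) (switch∈base h))

    lClasses : HasSize (IsLClass z n) 3
    lClasses = kinds-hasSize (lClass ∘ ⟦_⟧) isLClass⇔ base (lClasses-unique d) base-present complete
      where
      complete : ∀ κ → Present κ → lClass ⟦ κ ⟧ ∈ map (lClass ∘ ⟦_⟧) base
      complete κ p with present-kind κ p
      ... | inj₁ κ∈base    = ∈-map⁺ (lClass ∘ ⟦_⟧) κ∈base
      ... | inj₂ (h , refl) = subst (_∈ map (lClass ∘ ⟦_⟧) base) (sym (offDiagonal-lClass h))
                                    (∈-map⁺ (lClass ∘ ⟦_⟧) (switch∈base (not h)))

  open WithDiagonal (proj₁ diagonal) (proj₁ (proj₂ diagonal)) (proj₂ (proj₂ diagonal)) public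

proposition7p7 : (s : Word) → Sturmian s →
    HasSize (IsEdge s 1) 3
    × (∀ n → 2 ≤ n → HasSize (IsEdge s n) 4)
    × (∀ n → 1 ≤ n → ∃[ kL ] ∃[ kR ]
         (HasSize (IsLClass s n) kL × HasSize (IsRClass s n) kR × kL + kR ≡ 6))
proposition7p7 s sturmian = edges-of-order-1 , edges-of-order-≥2 , classes
  where
  module Graph = AbelianRauzyGraph s sturmian

  edges-of-order-1 : HasSize (IsEdge s 1) 3
  edges-of-order-1 = Graph.edges-without-offDiagonal 0 (Graph.offDiagonal-absent 0 refl)

  edges-of-order-≥2 : ∀ n → 2 ≤ n → HasSize (IsEdge s n) 4
  edges-of-order-≥2 1             (s≤s ())
  edges-of-order-≥2 (suc (suc m)) _ with o , present ← Graph.offDiagonal-present (suc m) z<s =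
    Graph.edges-with-offDiagonal (suc m) o present

  classes : ∀ n → 1 ≤ n → ∃[ kL ] ∃[ kR ] (HasSize (IsLClass s n) kL × HasSize (IsRClass s n) kR × kL + kR ≡ 6)
  classes (suc n′) _ = 3 , 3 , Graph.lClasses n′ , Graph.rClasses n′ , refl
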